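{- The modal logic $\Gamma(\mathbf{LP}_2,2,1)$ has the uniform Lyndon interpolation property.
   Context: Modal formulas use variables, $\bot,\land,\lor,\neg,\to,\Box$. Positive/negative variables: $v^+(p)=\{p\}$, $v^-(p)=\emptyset$, $v^\circ(\bot)=\emptyset$, $\land,\lor,\Box$ preserve polarity, $v^\pm(\neg\varphi)=v^\mp(\varphi)$, $v^+(\varphi\to\psi)=v^-(\varphi)\cup v^+(\psi)$, $v^-(\varphi\to\psi)=v^+(\varphi)\cup v^-(\psi)$. $\Gamma(\mathbf{LP}_2,2,1)$ is the set of modal formulas true at every world of every Kripke model on every finite frame of the following form: $W=\{r\}\cup C^0\cup\dots\cup C^{j}$ ($j\ge 0$) where the $C^k$ are pairwise disjoint two-element sets not containing $r$, and $R$ is reflexive, $rRx$ for all $x$, $xRy$ for all $x,y$ in the same $C^k$, and no other pairs (a root below finitely many two-element final clusters). A logic $L$ has the uniform Lyndon interpolation property iff for every formula $\varphi$ and finite sets $P^+,P^-$ of variables there is $\theta$ with $L\vdash\varphi\to\theta$, $v^\circ(\theta)\subseteq v^\circ(\varphi)\setminus P^\circ$ for $\circ\in\{+,-\}$, and $L\vdash\theta\to\psi$ for every $\psi$ with $L\vdash\varphi\to\psi$ and $v^\circ(\psi)\cap P^\circ=\emptyset$ for $\circ\in\{+,-\}$. -}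

module Defs where

open import Data.Nat using (ℕ; suc; _≟_)
open import Data.Fin using (Fin)
import Data.Fin as Fin
open import Data.Bool using (Bool; true; false; _∧_; _∨_; not; if_then_else_)
open import Data.Maybe using (Maybe; just; nothing)
open import Data.Product using (Σ; _×_; _,_)
open import Data.List using (List; []; _∷_; [_]; _++_; map; cartesianProduct; allFin)
open import Data.List.Membership.Propositional using (_∈_; _∉_)
open import Relation.Binary.PropositionalEquality using (_≡_)
open import Relation.Nullary using (does)

data Fm : Set where
  var  : ℕ → Fm
  ⊥'   : Fm
  _∧'_ : Fm → Fm → Fm
  _∨'_ : Fm → Fm → Fm
  ¬'_  : Fm → Fm
  _⇒'_ : Fm → Fm → Fm
  □_   : Fm → Fm

-- Positive / negative variables (as lists; only membership matters).
mutual
  v⁺ : Fm → List ℕ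
  v⁺ (var p)   = [ p ]
  v⁺ ⊥'        = []
  v⁺ (a ∧' b)  = v⁺ a ++ v⁺ b
  v⁺ (a ∨' b)  = v⁺ a ++ v⁺ b
  v⁺ (¬' a)    = v⁻ a
  v⁺ (a ⇒' b)  = v⁻ a ++ v⁺ b
  v⁺ (□ a)     = v⁺ a

  v⁻ : Fm → List ℕ
  v⁻ (var p)   = []
  v⁻ ⊥'        = []
  v⁻ (a ∧' b)  = v⁻ a ++ v⁻ b
  v⁻ (a ∨' b)  = v⁻ a ++ v⁻ b
  v⁻ (¬' a)    = v⁺ a
  v⁻ (a ⇒' b)  = v⁺ a ++ v⁻ b
  v⁻ (□ a)     = v⁻ a

-- The frame with root `nothing` and clusters C^0,...,C^j, where
-- cluster k = { just (k , false) , just (k , true) }.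
World : ℕ → Set
World j = Maybe (Fin (suc j) × Bool)

R : ∀ {j} → World j → World j → Bool
R nothing  _                    = true
R (just _) nothing              = false
R (just (k , _)) (just (k' , _)) = does (Fin.toℕ k ≟ Fin.toℕ k')

worlds : ∀ j → List (World j)
worlds j = nothing ∷ map just (cartesianProduct (allFin (suc j)) (false ∷ true ∷ []))

allB : ∀ {A : Set} → (A → Bool) → List A → Bool
allB f []       = true
allB f (x ∷ xs) = f x ∧ allB f xs

eval : ∀ j → (ℕ → World j → Bool) → World j → Fm → Bool
eval j V w (var p)  = V p w
eval j V w ⊥'       = false
eval j V w (a ∧' b) = eval j V w a ∧ eval j V w b
eval j V w (a ∨' b) = eval j V w a ∨ eval j V w b
eval j V w (¬' a)   = not (eval j V w a)
eval j V w (a ⇒' b) = not (eval j V w a) ∨ eval j V w b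
eval j V w (□ a)    = allB (λ u → not (R w u) ∨ eval j V u a) (worlds j)

-- L ⊢ φ  for  L = Γ(LP₂,2,1): φ true at every world of every model on every
-- frame of the given shape (every such frame is isomorphic to one above).
⊢Γ : Fm → Set
⊢Γ φ = ∀ (j : ℕ) (V : ℕ → World j → Bool) (w : World j) → eval j V w φ ≡ true

UniformLyndonInterpolation : (Fm → Set) → Set
UniformLyndonInterpolation ⊢ =
  ∀ (φ : Fm) (P⁺ P⁻ : List ℕ) →
  Σ Fm λ θ →
    ⊢ (φ ⇒' θ)
    × (∀ p → p ∈ v⁺ θ → p ∈ v⁺ φ × p ∉ P⁺)
    × (∀ p → p ∈ v⁻ θ → p ∈ v⁻ φ × p ∉ P⁻)
    × (∀ ψ → ⊢ (φ ⇒' ψ)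
           → (∀ p → p ∈ v⁺ ψ → p ∉ P⁺)
           → (∀ p → p ∈ v⁻ ψ → p ∉ P⁻)
           → ⊢ (θ ⇒' ψ))

{-# OPTIONS --safe #-}
-- Let S be the variables of φ, and call a literal allowed if its variable occurs in φ with that
-- polarity and is not excluded by P⁺ or P⁻.  A situation is a model of the same shape whose root
-- and clusters carry assignments to S; there are finitely many once repeated cluster assignments
-- are dropped, and every model is bisimilar to its own situation.  The interpolant is the
-- disjunction, over the situations whose root satisfies φ, of a description of the situation by
-- allowed literals only (the type of the root and which cluster types occur).  If the root of M
-- satisfies φ, its situation is among them and M satisfies its description.  Conversely, if M
-- satisfies the description of a situation σ, every cluster of M matches one of σ and vice
-- versa; the model whose clusters are the matching pairs is bisimilar to both, and its valuation
-- can be chosen so that φ transfers to it from σ and every ψ avoiding P⁺ and P⁻ transfers from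
-- it to M.  Validity reduces to validity at roots, since every cluster world is the image of the
-- root of a one-cluster frame under a bounded morphism.
module Submission where

open import Defs
open import Data.Nat using (ℕ)
import Data.Nat as ℕ
open import Data.Fin using (Fin; toℕ) renaming (zero to fzero; suc to fsuc)
open import Data.Fin.Properties using (toℕ-injective)
open import Data.Bool using (Bool; true; false; _∧_; _∨_; not; _xor_)
import Data.Bool as Bool
open import Data.Bool.Properties using (not-involutive)
open import Data.Maybe using (just; nothing)
open import Data.Product using (_×_; _,_; proj₁; proj₂; ∃; ∃₂)
import Data.Product.Properties as Product
open import Data.Sum using (_⊎_; inj₁; inj₂; [_,_]′)
open import Data.Empty using (⊥-elim)
open import Data.List using (List; []; _∷_; _++_; map; cartesianProduct; allFin; filter; lookup; length)
import Data.List.Properties as List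
open import Data.List.Relation.Unary.All using (All; []; _∷_)
import Data.List.Relation.Unary.All as All
open import Data.List.Relation.Unary.All.Properties using (++⁺)
open import Data.List.Relation.Unary.Any using (here; there; index)
open import Data.List.Relation.Unary.Any.Properties using (lookup-index)
open import Data.List.Membership.Propositional using (_∈_; _∉_)
open import Data.List.Membership.Propositional.Properties
  using (∈-++⁺ˡ; ∈-++⁺ʳ; ∈-map⁺; ∈-map⁻; ∈-cartesianProduct⁺; ∈-allFin; ∈-filter⁺; ∈-filter⁻;
         ∈-lookup)
open import Data.List.Membership.DecPropositional ℕ._≟_ using (_∈?_)
open import Function using (_∘′_; id; flip; case_of_)
open import Relation.Binary.Definitions using (DecidableEquality)
open import Relation.Binary.PropositionalEquality
  using (_≡_; refl; sym; trans; cong; subst; module ≡-Reasoning)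
open import Relation.Nullary using (Dec; yes; no; does)
open import Relation.Nullary.Decidable using (dec-true; dec-false; map′; _×-dec_; ¬?)
open import Relation.Unary using (Decidable)

∧ᵇ-intro : ∀ {a b} → a ≡ true → b ≡ true → a ∧ b ≡ true
∧ᵇ-intro refl refl = refl

∧ᵇ-elim : ∀ {a b} → a ∧ b ≡ true → a ≡ true × b ≡ true
∧ᵇ-elim {true} {true} _ = refl , refl

∨ᵇ-introˡ : ∀ {a b} → a ≡ true → a ∨ b ≡ true
∨ᵇ-introˡ refl = refl

∨ᵇ-introʳ : ∀ {a b} → b ≡ true → a ∨ b ≡ true
∨ᵇ-introʳ {true}  _ = refl
∨ᵇ-introʳ {false} h = h

∨ᵇ-elim : ∀ {a b} → a ∨ b ≡ true → a ≡ true ⊎ b ≡ true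
∨ᵇ-elim {true}  _ = inj₁ refl
∨ᵇ-elim {false} h = inj₂ h

⇒ᵇ-intro : ∀ {a b} → (a ≡ true → b ≡ true) → not a ∨ b ≡ true
⇒ᵇ-intro {false} _ = refl
⇒ᵇ-intro {true}  h = h refl

⇒ᵇ-elim : ∀ {a b} → not a ∨ b ≡ true → a ≡ true → b ≡ true
⇒ᵇ-elim h refl = h

∧ᵇ-mono : ∀ {a b a′ b′} → (a ≡ true → a′ ≡ true) → (b ≡ true → b′ ≡ true) →
          a ∧ b ≡ true → a′ ∧ b′ ≡ true
∧ᵇ-mono f g h = ∧ᵇ-intro (f (proj₁ (∧ᵇ-elim h))) (g (proj₂ (∧ᵇ-elim h)))

∨ᵇ-mono : ∀ {a b a′ b′} → (a ≡ true → a′ ≡ true) → (b ≡ true → b′ ≡ true) →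
          a ∨ b ≡ true → a′ ∨ b′ ≡ true
∨ᵇ-mono f g h = [ ∨ᵇ-introˡ ∘′ f , ∨ᵇ-introʳ ∘′ g ]′ (∨ᵇ-elim h)

notᵇ-antitone : ∀ {a b} → (b ≡ true → a ≡ true) → not a ≡ true → not b ≡ true
notᵇ-antitone {b = false} _ _ = refl
notᵇ-antitone {true}  {true} _ ()
notᵇ-antitone {false} {true} h _ with () ← h refl

xor-involutive : ∀ s b → s xor (s xor b) ≡ b
xor-involutive false b = refl
xor-involutive true  b = not-involutive b

bool-matching : {P Q : Bool → Set} → ∃ P → ∃ Q → (∀ b → P b ⊎ Q b) → ∃ λ s → P s × Q (not s)
bool-matching (false , p) (true  , q) _ = false , p , q
bool-matching (true  , p) (false , q) _ = true  , p , q
bool-matching (false , p) (false , q) cover =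
  [ (λ p′ → true , p′ , q) , (λ q′ → false , p , q′) ]′ (cover true)
bool-matching (true  , p) (true  , q) cover =
  [ (λ p′ → false , p′ , q) , (λ q′ → true , p , q′) ]′ (cover false)

allB-intro : ∀ {A : Set} {f : A → Bool} xs → (∀ {x} → x ∈ xs → f x ≡ true) → allB f xs ≡ true
allB-intro []       h = refl
allB-intro (x ∷ xs) h = ∧ᵇ-intro (h (here refl)) (allB-intro xs (h ∘′ there))

allB-elim : ∀ {A : Set} {f : A → Bool} {xs x} → allB f xs ≡ true → x ∈ xs → f x ≡ true
allB-elim h (here refl) = proj₁ (∧ᵇ-elim h)
allB-elim h (there m)   = allB-elim (proj₂ (∧ᵇ-elim h)) m

allB-false : ∀ {A : Set} (f : A → Bool) xs → allB f xs ≡ false → ∃ λ x → x ∈ xs × f x ≡ false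
allB-false f (x ∷ xs) h with f x in fx
... | false = x , here refl , fx
... | true with allB-false f xs h
...   | y , m , fy = y , there m , fy

sublists : ∀ {A : Set} → List A → List (List A)
sublists []       = [] ∷ []
sublists (x ∷ xs) = map (x ∷_) (sublists xs) ++ sublists xs

filter∈sublists : ∀ {A : Set} {P : A → Set} (P? : Decidable P) xs → filter P? xs ∈ sublists xs
filter∈sublists P? []       = here refl
filter∈sublists P? (x ∷ xs) with does (P? x)
... | true  = ∈-++⁺ˡ (∈-map⁺ (x ∷_) (filter∈sublists P? xs))
... | false = ∈-++⁺ʳ (map (x ∷_) (sublists xs)) (filter∈sublists P? xs)

∈-bools : ∀ b → b ∈ false ∷ true ∷ []
∈-bools false = here refl
∈-bools true  = there (here refl)

∈-worlds : ∀ j (w : World j) → w ∈ worlds j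
∈-worlds j nothing        = here refl
∈-worlds j (just (k , b)) = there (∈-map⁺ just (∈-cartesianProduct⁺ (∈-allFin k) (∈-bools b)))

-- This is R (just (k , b)) (just (k , b′)) ≡ true, stated so that b and b′ need not be inferred.
R-cluster : ∀ {j} (k : Fin (ℕ.suc j)) → does (toℕ k ℕ.≟ toℕ k) ≡ true
R-cluster k = dec-true (toℕ k ℕ.≟ toℕ k) refl

R-cluster⁻ : ∀ {j} {k : Fin (ℕ.suc j)} {b} u → R (just (k , b)) u ≡ true →
             ∃ λ b′ → u ≡ just (k , b′)
R-cluster⁻ nothing ()
R-cluster⁻ {k = k} (just (k′ , b′)) r =
  b′ , cong (λ i → just (i , b′)) (sym (toℕ-injective (does-true (toℕ k ℕ.≟ toℕ k′) r)))
  where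
    does-true : ∀ {A : Set} (d : Dec A) → does d ≡ true → A
    does-true (yes a) _ = a

⊤' : Fm
⊤' = ¬' ⊥'

◇_ : Fm → Fm
◇ a = ¬' (□ (¬' a))

⋀ : List Fm → Fm
⋀ []       = ⊤'
⋀ (a ∷ as) = a ∧' ⋀ as

⋁ : List Fm → Fm
⋁ []       = ⊥'
⋁ (a ∷ as) = a ∨' ⋁ as

guard : ∀ {A : Set} → Dec A → Fm → Fm
guard (yes _) a = a
guard (no _)  _ = ⊤'

Valuation : ℕ → Set
Valuation j = ℕ → World j → Bool

module Semantics {j : ℕ} (V : Valuation j) where

  infix 4 _⊩_
  record _⊩_ (w : World j) (a : Fm) : Set where
    constructor sat
    field truth : eval j V w a ≡ true
  open _⊩_ public

  ⊩? : ∀ w a → Dec (w ⊩ a)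
  ⊩? w a = map′ sat truth (eval j V w a Bool.≟ true)

  ∧-intro : ∀ {w a b} → w ⊩ a → w ⊩ b → w ⊩ a ∧' b
  ∧-intro (sat ha) (sat hb) = sat (∧ᵇ-intro ha hb)

  ∧-elimˡ : ∀ {w a b} → w ⊩ a ∧' b → w ⊩ a
  ∧-elimˡ (sat h) = sat (proj₁ (∧ᵇ-elim h))

  ∧-elimʳ : ∀ {w a b} → w ⊩ a ∧' b → w ⊩ b
  ∧-elimʳ (sat h) = sat (proj₂ (∧ᵇ-elim h))

  ∨-introˡ : ∀ {w a b} → w ⊩ a → w ⊩ a ∨' b
  ∨-introˡ (sat h) = sat (∨ᵇ-introˡ h)

  ∨-introʳ : ∀ {w a b} → w ⊩ b → w ⊩ a ∨' b
  ∨-introʳ (sat h) = sat (∨ᵇ-introʳ h)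

  ∨-elim : ∀ {w a b} → w ⊩ a ∨' b → w ⊩ a ⊎ w ⊩ b
  ∨-elim (sat h) = [ inj₁ ∘′ sat , inj₂ ∘′ sat ]′ (∨ᵇ-elim h)

  ⇒-intro : ∀ {w a b} → (w ⊩ a → w ⊩ b) → w ⊩ a ⇒' b
  ⇒-intro h = sat (⇒ᵇ-intro (truth ∘′ h ∘′ sat))

  □-intro : ∀ {w a} → (∀ u → R w u ≡ true → u ⊩ a) → w ⊩ □ a
  □-intro {w} {a} h =
    sat (allB-intro {f = λ u → not (R w u) ∨ eval j V u a} (worlds j) λ {u} _ →
           ⇒ᵇ-intro (truth ∘′ h u))

  □-elim : ∀ {w a u} → w ⊩ □ a → R w u ≡ true → u ⊩ a
  □-elim {w} {a} {u} (sat h) r =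
    sat (⇒ᵇ-elim (allB-elim {f = λ u → not (R w u) ∨ eval j V u a} h (∈-worlds j u)) r)

  □-root : ∀ {w a} → nothing ⊩ □ a → w ⊩ □ a
  □-root h = □-intro λ _ _ → □-elim h refl

  ◇-intro : ∀ {w a u} → R w u ≡ true → u ⊩ a → w ⊩ ◇ a
  ◇-intro {w} {a} r (sat h) = sat (notᵇ-antitone {false} (λ □¬a →
    subst (λ x → not x ≡ true) h (truth (□-elim {w} {¬' a} (sat □¬a) r))) refl)

  ◇-elim : ∀ {w a} → w ⊩ ◇ a → ∃ λ u → R w u ≡ true × u ⊩ a
  ◇-elim {w} {a} (sat h) with allB-false (λ u → not (R w u) ∨ not (eval j V u a)) (worlds j) (not-true h)
    where
      not-true : ∀ {x} → not x ≡ true → x ≡ false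
      not-true {false} _ = refl
  ... | u , _ , e = u , proj₁ (nor e) , sat (proj₂ (nor e))
    where
      nor : ∀ {x y} → not x ∨ not y ≡ false → x ≡ true × y ≡ true
      nor {true} {true} _ = refl , refl

  guard-intro : ∀ {A : Set} (d : Dec A) {w a} → (A → w ⊩ a) → w ⊩ guard d a
  guard-intro (yes x) h = h x
  guard-intro (no _)  _ = sat refl

  guard-elim : ∀ {A : Set} (d : Dec A) {w a} → A → w ⊩ guard d a → w ⊩ a
  guard-elim (yes _)  _ h = h
  guard-elim (no ¬x) x _ = ⊥-elim (¬x x)

  ⋀-intro : ∀ {A : Set} {f : A → Fm} {w} xs → (∀ {x} → x ∈ xs → w ⊩ f x) → w ⊩ ⋀ (map f xs)
  ⋀-intro []       h = sat refl
  ⋀-intro (x ∷ xs) h = ∧-intro (h (here refl)) (⋀-intro xs (h ∘′ there))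

  ⋀-elim : ∀ {A : Set} {f : A → Fm} {w xs x} → w ⊩ ⋀ (map f xs) → x ∈ xs → w ⊩ f x
  ⋀-elim h (here refl) = ∧-elimˡ h
  ⋀-elim h (there m)   = ⋀-elim (∧-elimʳ h) m

  ⋁-intro : ∀ {A : Set} {f : A → Fm} {w xs x} → x ∈ xs → w ⊩ f x → w ⊩ ⋁ (map f xs)
  ⋁-intro (here refl) h = ∨-introˡ h
  ⋁-intro (there m)   h = ∨-introʳ (⋁-intro m h)

  ⋁-elim : ∀ {A : Set} {f : A → Fm} {w} xs → w ⊩ ⋁ (map f xs) → ∃ λ x → x ∈ xs × w ⊩ f x
  ⋁-elim (x ∷ xs) h with ∨-elim h
  ... | inj₁ hx = x , here refl , hx
  ... | inj₂ hs with ⋁-elim xs hs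
  ...   | y , m , hy = y , there m , hy

record Bisim {j₁ j₂} (Z : World j₁ → World j₂ → Set) : Set where
  field
    forth : ∀ {x y x′} → Z x y → R x x′ ≡ true → ∃ λ y′ → R y y′ ≡ true × Z x′ y′
    back  : ∀ {x y y′} → Z x y → R y y′ ≡ true → ∃ λ x′ → R x x′ ≡ true × Z x′ y′

open Bisim

flip-bisim : ∀ {j₁ j₂} {Z : World j₁ → World j₂ → Set} → Bisim Z → Bisim (flip Z)
flip-bisim B = record { forth = back B ; back = forth B }

module _ {j₁ j₂} {Z : World j₁ → World j₂ → Set} where

  Transfers : Valuation j₁ → Valuation j₂ → List ℕ → Set
  Transfers V₁ V₂ ps = ∀ {p} → p ∈ ps → ∀ {x y} → Z x y → V₁ p x ≡ true → V₂ p y ≡ true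

  module _ {V₁ : Valuation j₁} {V₂ : Valuation j₂} where

    transfers-++ˡ : ∀ {xs ys} → Transfers V₁ V₂ (xs ++ ys) → Transfers V₁ V₂ xs
    transfers-++ˡ h m = h (∈-++⁺ˡ m)

    transfers-++ʳ : ∀ xs {ys} → Transfers V₁ V₂ (xs ++ ys) → Transfers V₁ V₂ ys
    transfers-++ʳ xs h m = h (∈-++⁺ʳ xs m)

-- Negative variables transfer backwards, so that a negation just flips the bisimulation.
preserves : ∀ {j₁ j₂} {Z : World j₁ → World j₂ → Set} {V₁ : Valuation j₁} {V₂ : Valuation j₂} →
            Bisim Z → ∀ a →
            Transfers {Z = Z} V₁ V₂ (v⁺ a) → Transfers {Z = flip Z} V₂ V₁ (v⁻ a) →
            ∀ {x y} → Z x y → eval j₁ V₁ x a ≡ true → eval j₂ V₂ y a ≡ true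
preserves B (var p)  hp hn z = hp (here refl) z
preserves B ⊥'       hp hn z ()
preserves B (a ∧' b) hp hn z =
  ∧ᵇ-mono (preserves B a (transfers-++ˡ hp) (transfers-++ˡ hn) z)
          (preserves B b (transfers-++ʳ (v⁺ a) hp) (transfers-++ʳ (v⁻ a) hn) z)
preserves B (a ∨' b) hp hn z =
  ∨ᵇ-mono (preserves B a (transfers-++ˡ hp) (transfers-++ˡ hn) z)
          (preserves B b (transfers-++ʳ (v⁺ a) hp) (transfers-++ʳ (v⁻ a) hn) z)
preserves B (¬' a)   hp hn z = notᵇ-antitone (preserves (flip-bisim B) a hn hp z)
preserves B (a ⇒' b) hp hn z =
  ∨ᵇ-mono (notᵇ-antitone (preserves (flip-bisim B) a (transfers-++ˡ hn) (transfers-++ˡ hp) z))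
          (preserves B b (transfers-++ʳ (v⁻ a) hp) (transfers-++ʳ (v⁺ a) hn) z)
preserves {V₁ = V₁} {V₂} B (□ a) hp hn {x} {y} z h =
  truth (Semantics.□-intro V₂ {y} {a} λ u r → case back B z r of λ where
    (x′ , r′ , z′) → sat (preserves B a hp hn z′ (truth (Semantics.□-elim V₁ {x} {a} (sat h) r′))))
  where open Semantics using (sat; truth)

data Induced {j₁ j₂} (C : Fin (ℕ.suc j₁) → Fin (ℕ.suc j₂) → Set) (τ : Fin (ℕ.suc j₁) → Bool) :
             World j₁ → World j₂ → Set where
  root    : Induced C τ nothing nothing
  cluster : ∀ {k i} b → C k i → Induced C τ (just (k , b)) (just (i , τ k xor b))

module _ {j₁ j₂} {C : Fin (ℕ.suc j₁) → Fin (ℕ.suc j₂) → Set} {τ : Fin (ℕ.suc j₁) → Bool} where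

  cluster⁻¹ : ∀ {k i} b → C k i → Induced C τ (just (k , τ k xor b)) (just (i , b))
  cluster⁻¹ {k} {i} b c =
    subst (λ b′ → Induced C τ (just (k , τ k xor b)) (just (i , b′))) (xor-involutive (τ k) b) (cluster _ c)

  induced-bisim : (∀ k → ∃ (C k)) → (∀ i → ∃ λ k → C k i) → Bisim (Induced C τ)
  induced-bisim total onto = record { forth = forth′ ; back = back′ }
    where
      forth′ : ∀ {x y x′} → Induced C τ x y → R x x′ ≡ true →
               ∃ λ y′ → R y y′ ≡ true × Induced C τ x′ y′
      forth′ {x′ = nothing}      root _ = nothing , refl , root
      forth′ {x′ = just (k , b)} root _ = let i , c = total k in just (i , τ k xor b) , refl , cluster b c
      forth′ {x′ = x′} (cluster {k} {i} b c) r with R-cluster⁻ x′ r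
      ... | b′ , refl = just (i , τ k xor b′) , R-cluster i , cluster b′ c

      back′ : ∀ {x y y′} → Induced C τ x y → R y y′ ≡ true →
              ∃ λ x′ → R x x′ ≡ true × Induced C τ x′ y′
      back′ {y′ = nothing}      root _ = nothing , refl , root
      back′ {y′ = just (i , b)} root _ = let k , c = onto i in just (k , τ k xor b) , refl , cluster⁻¹ b c
      back′ {y′ = y′} (cluster {k} {i} b c) r with R-cluster⁻ y′ r
      ... | b′ , refl = just (k , τ k xor b′) , R-cluster k , cluster⁻¹ b′ c

ValidAtRoots : Fm → Set
ValidAtRoots a = ∀ j (V : Valuation j) → eval j V nothing a ≡ true

valid-from-roots : ∀ a → ValidAtRoots a → ⊢Γ a
valid-from-roots a h j V nothing        = h j V
valid-from-roots a h j V (just (k , b)) =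
  preserves {V₁ = λ p u → V p (into u)} {V₂ = V} into-bisim a
    (λ { _ refl v → v }) (λ { _ refl v → v }) refl (h 0 _)
  where
    into : World 0 → World j
    into nothing         = just (k , b)
    into (just (_ , b′)) = just (k , b′)

    into-bisim : Bisim (λ x y → into x ≡ y)
    forth into-bisim {nothing}      {x′ = nothing}       refl _ = _ , R-cluster k , refl
    forth into-bisim {nothing}      {x′ = just (_ , b′)} refl _ = _ , R-cluster k , refl
    forth into-bisim {just (_ , _)} {x′ = just (_ , b′)} refl _ = _ , R-cluster k , refl
    back  into-bisim {nothing}          {y′ = y′} refl r with R-cluster⁻ y′ r
    ... | b′ , refl = just (fzero , b′) , refl , refl
    back  into-bisim {just (fzero , _)} {y′ = y′} refl r with R-cluster⁻ y′ r
    ... | b′ , refl = just (fzero , b′) , refl , refl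

-- An assignment is represented by the list of variables it makes true.
Assignment : Set
Assignment = List ℕ

holds : Assignment → ℕ → Bool
holds a p = does (p ∈? a)

assignment : ∀ {j} → List ℕ → Valuation j → World j → Assignment
assignment S V w = filter (λ q → V q w Bool.≟ true) S

holds-assignment : ∀ {j S} (V : Valuation j) w {p} → p ∈ S → holds (assignment S V w) p ≡ V p w
holds-assignment {S = S} V w {p} m with V p w in e
... | true  = dec-true (p ∈? assignment S V w) (∈-filter⁺ (λ q → V q w Bool.≟ true) m e)
... | false = dec-false (p ∈? assignment S V w) λ m′ →
  case trans (sym (proj₂ (∈-filter⁻ (λ q → V q w Bool.≟ true) {xs = S} m′))) e of λ ()

Assignment² : Set
Assignment² = Assignment × Assignment

_≟²_ : DecidableEquality Assignment²
_≟²_ = Product.≡-dec (List.≡-dec ℕ._≟_) (List.≡-dec ℕ._≟_)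

side : Bool → Assignment² → Assignment
side false = proj₁
side true  = proj₂

module Interpolant (φ : Fm) (P⁺ P⁻ : List ℕ) where

  S : List ℕ
  S = v⁺ φ ++ v⁻ φ

  Allowed⁺ Allowed⁻ : ℕ → Set
  Allowed⁺ p = p ∈ v⁺ φ × p ∉ P⁺
  Allowed⁻ p = p ∈ v⁻ φ × p ∉ P⁻

  allowed⁺? : Decidable Allowed⁺
  allowed⁺? p = p ∈? v⁺ φ ×-dec ¬? (p ∈? P⁺)

  allowed⁻? : Decidable Allowed⁻
  allowed⁻? p = p ∈? v⁻ φ ×-dec ¬? (p ∈? P⁻)

  record Admissible (a : Fm) : Set where
    constructor _,_
    field
      positive : All Allowed⁺ (v⁺ a)
      negative : All Allowed⁻ (v⁻ a)

  open Admissible public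

  admissible-∧ : ∀ {a b} → Admissible a → Admissible b → Admissible (a ∧' b)
  admissible-∧ (a⁺ , a⁻) (b⁺ , b⁻) = ++⁺ a⁺ b⁺ , ++⁺ a⁻ b⁻

  admissible-∨ : ∀ {a b} → Admissible a → Admissible b → Admissible (a ∨' b)
  admissible-∨ (a⁺ , a⁻) (b⁺ , b⁻) = ++⁺ a⁺ b⁺ , ++⁺ a⁻ b⁻

  admissible-□ : ∀ {a} → Admissible a → Admissible (□ a)
  admissible-□ (a⁺ , a⁻) = a⁺ , a⁻

  admissible-◇ : ∀ {a} → Admissible a → Admissible (◇ a)
  admissible-◇ (a⁺ , a⁻) = a⁺ , a⁻

  admissible-guard : ∀ {A : Set} (d : Dec A) {a} → (A → Admissible a) → Admissible (guard d a)
  admissible-guard (yes x) h = h x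
  admissible-guard (no _)  _ = [] , []

  admissible-⋀ : ∀ {A : Set} {f : A → Fm} xs → (∀ x → Admissible (f x)) → Admissible (⋀ (map f xs))
  admissible-⋀ []       h = [] , []
  admissible-⋀ (x ∷ xs) h = admissible-∧ (h x) (admissible-⋀ xs h)

  admissible-⋁ : ∀ {A : Set} {f : A → Fm} xs → (∀ x → Admissible (f x)) → Admissible (⋁ (map f xs))
  admissible-⋁ []       h = [] , []
  admissible-⋁ (x ∷ xs) h = admissible-∨ (h x) (admissible-⋁ xs h)

  literal : ℕ → Bool → Fm
  literal q true  = guard (allowed⁺? q) (var q)
  literal q false = guard (allowed⁻? q) (¬' var q)

  lits : Assignment → Fm
  lits a = ⋀ (map (λ q → literal q (holds a q)) S)

  admissible-lits : ∀ a → Admissible (lits a)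
  admissible-lits a = admissible-⋀ S λ q → admissible-literal q (holds a q)
    where
      admissible-literal : ∀ q b → Admissible (literal q b)
      admissible-literal q true  = admissible-guard (allowed⁺? q) λ allowed → allowed ∷ [] , []
      admissible-literal q false = admissible-guard (allowed⁻? q) λ allowed → [] , allowed ∷ []

  module _ {j} {V : Valuation j} where
    open Semantics V

    lits-own : ∀ w → w ⊩ lits (assignment S V w)
    lits-own w = ⋀-intro S λ {q} m →
      subst (λ b → w ⊩ literal q b) (sym (holds-assignment V w m)) (literal-own q)
      where
        literal-own : ∀ q → w ⊩ literal q (V q w)
        literal-own q with V q w in e
        ... | true  = guard-intro (allowed⁺? q) λ _ → sat e
        ... | false = guard-intro (allowed⁻? q) λ _ → sat (cong not e)

    lits-sound⁺ : ∀ {w} a {p} → w ⊩ lits a → Allowed⁺ p → holds a p ≡ true → V p w ≡ true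
    lits-sound⁺ {w} a {p} h allowed t = truth (guard-elim (allowed⁺? p) allowed
      (subst (λ b → w ⊩ literal p b) t (⋀-elim h (∈-++⁺ˡ (proj₁ allowed)))))

    lits-sound⁻ : ∀ {w} a {p} → w ⊩ lits a → Allowed⁻ p → V p w ≡ true → holds a p ≡ true
    lits-sound⁻ {w} a {p} h allowed v with holds a p in e
    ... | true  = refl
    ... | false with () ← subst (λ x → not x ≡ true) v (truth (guard-elim (allowed⁻? p) allowed
                            (subst (λ b → w ⊩ literal p b) e
                              (⋀-elim h (∈-++⁺ʳ (v⁺ φ) (proj₁ allowed))))))

  inCluster : Assignment² → Fm
  inCluster c =
    ((◇ lits (proj₁ c)) ∧' (◇ lits (proj₂ c))) ∧' (□ (lits (proj₁ c) ∨' lits (proj₂ c)))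

  -- Unlike inCluster c, this still pins down a cluster realising c when it holds at the root.
  inCluster⁺ : Assignment² → Fm
  inCluster⁺ c = inCluster c ∧' ((□ (◇ lits (proj₁ c))) ∧' (□ (◇ lits (proj₂ c))))

  seesAll : List Assignment² → Fm
  seesAll K = ⋀ (map (λ c → ◇ inCluster⁺ c) K)

  inSome : List Assignment² → Fm
  inSome K = ⋁ (map inCluster K)

  -- The cluster assignments are given as c ∷ cs so that there is at least one cluster.
  Situation : Set
  Situation = Assignment × Assignment² × List Assignment²

  clusters : Situation → List Assignment²
  clusters (_ , c , cs) = c ∷ cs

  lastCluster : Situation → ℕ
  lastCluster (_ , _ , cs) = length cs

  model : (σ : Situation) → Valuation (lastCluster σ)
  model σ p nothing        = holds (proj₁ σ) p
  model σ p (just (i , b)) = holds (side b (lookup (clusters σ) i)) p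

  -- The root is its own successor, and it is seesAll that holds there.
  describe : Situation → Fm
  describe σ =
    lits (proj₁ σ) ∧' (seesAll (clusters σ) ∧' (□ (inSome (clusters σ) ∨' seesAll (clusters σ))))

  pairs : List Assignment²
  pairs = cartesianProduct (sublists S) (sublists S)

  situations : List Situation
  situations = cartesianProduct (sublists S) (cartesianProduct pairs (sublists pairs))

  Satisfies : Situation → Set
  Satisfies σ = eval (lastCluster σ) (model σ) nothing φ ≡ true

  satisfies? : Decidable Satisfies
  satisfies? σ = eval (lastCluster σ) (model σ) nothing φ Bool.≟ true

  interpolant : Fm
  interpolant = ⋁ (map describe (filter satisfies? situations))

  admissible-interpolant : Admissible interpolant
  admissible-interpolant = admissible-⋁ (filter satisfies? situations) admissible-describe
    where
      admissible-inCluster : ∀ c → Admissible (inCluster c)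
      admissible-inCluster (a , a′) =
        admissible-∧ (admissible-∧ (admissible-◇ (admissible-lits a)) (admissible-◇ (admissible-lits a′)))
                     (admissible-□ (admissible-∨ (admissible-lits a) (admissible-lits a′)))

      admissible-seesAll : ∀ K → Admissible (seesAll K)
      admissible-seesAll K = admissible-⋀ K λ (a , a′) →
        admissible-◇ (admissible-∧ (admissible-inCluster (a , a′))
          (admissible-∧ (admissible-□ (admissible-◇ (admissible-lits a)))
                        (admissible-□ (admissible-◇ (admissible-lits a′)))))

      admissible-describe : ∀ σ → Admissible (describe σ)
      admissible-describe σ =
        admissible-∧ (admissible-lits (proj₁ σ)) (admissible-∧ (admissible-seesAll (clusters σ))
          (admissible-□ (admissible-∨ (admissible-⋁ (clusters σ) admissible-inCluster)
                                      (admissible-seesAll (clusters σ)))))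

  module Abstraction {j} (V : Valuation j) where
    open Semantics V
    open import Data.List.Membership.DecPropositional _≟²_ using () renaming (_∈?_ to _∈²?_)

    type : World j → Assignment
    type = assignment S V

    clusterType : Fin (ℕ.suc j) → Assignment²
    clusterType k = type (just (k , false)) , type (just (k , true))

    side-clusterType : ∀ k b → side b (clusterType k) ≡ type (just (k , b))
    side-clusterType k false = refl
    side-clusterType k true  = refl

    inCluster-own : ∀ k b → just (k , b) ⊩ inCluster (clusterType k)
    inCluster-own k b =
      ∧-intro (∧-intro (◇-intro (R-cluster k) (lits-own (just (k , false))))
                       (◇-intro (R-cluster k) (lits-own (just (k , true)))))
              (□-intro own)
      where
        own : ∀ u → R (just (k , b)) u ≡ true →
              u ⊩ lits (type (just (k , false))) ∨' lits (type (just (k , true)))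
        own u r with R-cluster⁻ u r
        ... | false , refl = ∨-introˡ (lits-own _)
        ... | true  , refl = ∨-introʳ (lits-own _)

    inCluster⁺-own : ∀ k b → just (k , b) ⊩ inCluster⁺ (clusterType k)
    inCluster⁺-own k b = ∧-intro (inCluster-own k b) (∧-intro (□-intro (sees false)) (□-intro (sees true)))
      where
        sees : ∀ b′ u → R (just (k , b)) u ≡ true → u ⊩ ◇ lits (type (just (k , b′)))
        sees b′ u r with R-cluster⁻ u r
        ... | _ , refl = ◇-intro (R-cluster k) (lits-own (just (k , b′)))

    abstraction : Situation
    abstraction = type nothing , clusterType fzero , filter (_∈²? map clusterType (allFin _)) pairs

    clusterType∈clusters : ∀ k → clusterType k ∈ clusters abstraction
    clusterType∈clusters k = there (∈-filter⁺ (_∈²? map clusterType (allFin _))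
      (∈-cartesianProduct⁺ (filter∈sublists _ S) (filter∈sublists _ S))
      (∈-map⁺ clusterType (∈-allFin k)))

    ∈clusters⇒clusterType : ∀ {c} → c ∈ clusters abstraction → ∃ λ k → c ≡ clusterType k
    ∈clusters⇒clusterType (here refl) = fzero , refl
    ∈clusters⇒clusterType (there m)
      with ∈-map⁻ clusterType (proj₂ (∈-filter⁻ (_∈²? map clusterType (allFin _)) {xs = pairs} m))
    ... | k , _ , e = k , e

    Represents : Fin (ℕ.suc j) → Fin (ℕ.suc (lastCluster abstraction)) → Set
    Represents k i = lookup (clusters abstraction) i ≡ clusterType k

    abstraction-bisim : Bisim (Induced Represents (λ _ → false))
    abstraction-bisim = induced-bisim total onto
      where
        total : ∀ k → ∃ (Represents k)
        total k = index (clusterType∈clusters k) , sym (lookup-index (clusterType∈clusters k))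

        onto : ∀ i → ∃ λ k → Represents k i
        onto i = ∈clusters⇒clusterType (∈-lookup i)

    agrees : ∀ {p} → p ∈ S → ∀ {x y} → Induced Represents (λ _ → false) x y →
             V p x ≡ model abstraction p y
    agrees m root = sym (holds-assignment V nothing m)
    agrees {p} m (cluster {k} {i} b e) = begin
      V p (just (k , b))                                  ≡⟨ holds-assignment V (just (k , b)) m ⟨
      holds (type (just (k , b))) p                       ≡⟨ cong (λ a → holds a p) (side-clusterType k b) ⟨
      holds (side b (clusterType k)) p                    ≡⟨ cong (λ c → holds (side b c) p) e ⟨
      holds (side b (lookup (clusters abstraction) i)) p  ∎
      where open ≡-Reasoning

    satisfies-abstraction : nothing ⊩ φ → Satisfies abstraction
    satisfies-abstraction (sat h) = preserves abstraction-bisim φ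
      (λ m z hx → trans (sym (agrees (∈-++⁺ˡ m) z)) hx)
      (λ m z hy → trans (agrees (∈-++⁺ʳ (v⁺ φ) m) z) hy)
      root h

    describes-abstraction : nothing ⊩ describe abstraction
    describes-abstraction = ∧-intro (lits-own nothing) (∧-intro sees-all (□-intro successor))
      where
        sees-all : nothing ⊩ seesAll (clusters abstraction)
        sees-all = ⋀-intro (clusters abstraction) λ m → case ∈clusters⇒clusterType m of λ where
          (k , refl) → ◇-intro {u = just (k , false)} refl (inCluster⁺-own k false)

        successor : ∀ u → R nothing u ≡ true →
                    u ⊩ inSome (clusters abstraction) ∨' seesAll (clusters abstraction)
        successor nothing        _ = ∨-introʳ sees-all
        successor (just (k , b)) _ = ∨-introˡ (⋁-intro (clusterType∈clusters k) (inCluster-own k b))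

    root-φ⇒interpolant : nothing ⊩ φ → nothing ⊩ interpolant
    root-φ⇒interpolant h =
      ⋁-intro (∈-filter⁺ satisfies? abstraction∈situations (satisfies-abstraction h)) describes-abstraction
      where
        abstraction∈situations : abstraction ∈ situations
        abstraction∈situations = ∈-cartesianProduct⁺ (filter∈sublists _ S)
          (∈-cartesianProduct⁺ (∈-cartesianProduct⁺ (filter∈sublists _ S) (filter∈sublists _ S))
                               (filter∈sublists _ pairs))

  module Matching {j} (V : Valuation j) where
    open Semantics V

    record Matches (k : Fin (ℕ.suc j)) (c : Assignment²) (s : Bool) : Set where
      constructor matches
      field
        first  : just (k , s) ⊩ lits (proj₁ c)
        second : just (k , not s) ⊩ lits (proj₂ c)

    matches? : ∀ k c s → Dec (Matches k c s)
    matches? k c s = map′ (λ (h₁ , h₂) → matches h₁ h₂) (λ (matches h₁ h₂) → h₁ , h₂) (⊩? _ _ ×-dec ⊩? _ _)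

    matches-side : ∀ {k c s} → Matches k c s → ∀ b → just (k , s xor b) ⊩ lits (side b c)
    matches-side {s = false} (matches h _) false = h
    matches-side {s = false} (matches _ h) true  = h
    matches-side {s = true}  (matches h _) false = h
    matches-side {s = true}  (matches _ h) true  = h

    seesAll-elim : ∀ {w} K {c} → w ⊩ seesAll K → c ∈ K → w ⊩ ◇ inCluster⁺ c
    seesAll-elim K = ⋀-elim {f = λ c → ◇ inCluster⁺ c} {xs = K}

    cluster-◇ : ∀ {k b a} → just (k , b) ⊩ ◇ a → ∃ λ b′ → just (k , b′) ⊩ a
    cluster-◇ h with ◇-elim h
    ... | u , r , hu with R-cluster⁻ u r
    ...   | b′ , refl = b′ , hu

    inCluster⇒matches : ∀ {k b} c → just (k , b) ⊩ inCluster c → ∃ (Matches k c)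
    inCluster⇒matches {k} c h =
      let s , h₁ , h₂ = bool-matching (cluster-◇ (∧-elimˡ (∧-elimˡ h))) (cluster-◇ (∧-elimʳ (∧-elimˡ h)))
                          λ b′ → ∨-elim (□-elim {u = just (k , b′)} (∧-elimʳ h) (R-cluster k))
      in s , matches h₁ h₂

    inCluster⁺⇒inCluster : ∀ {w} c → w ⊩ inCluster⁺ c → ∃₂ λ k b → just (k , b) ⊩ inCluster c
    inCluster⁺⇒inCluster {just (k , b)} c h = k , b , ∧-elimˡ h
    inCluster⁺⇒inCluster {nothing}      c h = fzero , false ,
      ∧-intro (∧-intro (□-elim (∧-elimˡ (∧-elimʳ h)) refl) (□-elim (∧-elimʳ (∧-elimʳ h)) refl))
              (□-root (∧-elimʳ (∧-elimˡ h)))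

  -- Truth in the refined model: it has to lie above the situation model on v⁺ φ and below it on
  -- v⁻ φ, above M off P⁻ and below M off P⁺.  These demands clash only on allowed variables,
  -- where lits orders the situation model and M the right way.
  merge : ℕ → Bool → Bool → Bool
  merge p x y with p ∈? P⁺ | p ∈? P⁻
  ... | yes _ | yes _ = x
  ... | yes _ | no  _ = x ∨ y
  ... | no  _ | yes _ = x ∧ y
  ... | no  _ | no  _ = y

  situation⇒merge : ∀ {p x y} → p ∈ v⁺ φ → (Allowed⁺ p → x ≡ true → y ≡ true) →
                    x ≡ true → merge p x y ≡ true
  situation⇒merge {p} m up hx with p ∈? P⁺ | p ∈? P⁻
  ... | yes _  | yes _ = hx
  ... | yes _  | no  _ = ∨ᵇ-introˡ hx
  ... | no ∉P⁺ | yes _ = ∧ᵇ-intro hx (up (m , ∉P⁺) hx)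
  ... | no ∉P⁺ | no  _ = up (m , ∉P⁺) hx

  merge⇒situation : ∀ {p x y} → p ∈ v⁻ φ → (Allowed⁻ p → y ≡ true → x ≡ true) →
                    merge p x y ≡ true → x ≡ true
  merge⇒situation {p} m down h with p ∈? P⁺ | p ∈? P⁻
  ... | yes _ | yes _  = h
  ... | yes _ | no ∉P⁻ = [ id , down (m , ∉P⁻) ]′ (∨ᵇ-elim h)
  ... | no  _ | yes _  = proj₁ (∧ᵇ-elim h)
  ... | no  _ | no ∉P⁻ = down (m , ∉P⁻) h

  merge⇒model : ∀ {p x y} → p ∉ P⁺ → merge p x y ≡ true → y ≡ true
  merge⇒model {p} ∉P⁺ h with p ∈? P⁺ | p ∈? P⁻
  ... | yes ∈P⁺ | _     = ⊥-elim (∉P⁺ ∈P⁺)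
  ... | no  _   | yes _ = proj₂ (∧ᵇ-elim h)
  ... | no  _   | no  _ = h

  model⇒merge : ∀ {p x y} → p ∉ P⁻ → y ≡ true → merge p x y ≡ true
  model⇒merge {p} ∉P⁻ h with p ∈? P⁺ | p ∈? P⁻
  ... | _     | yes ∈P⁻ = ⊥-elim (∉P⁻ ∈P⁻)
  ... | yes _ | no  _   = ∨ᵇ-introʳ h
  ... | no  _ | no  _   = h

  module Refinement {j} (V : Valuation j) (σ : Situation) (hσ : Semantics._⊩_ V nothing (describe σ)) where
    open Semantics V
    open Matching V

    situation-covered : ∀ i → ∃₂ λ k s → Matches k (lookup (clusters σ) i) s
    situation-covered i =
      let _ , _ , hu = ◇-elim (seesAll-elim (clusters σ) (∧-elimˡ (∧-elimʳ hσ)) (∈-lookup i))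
          k , _ , hk = inCluster⁺⇒inCluster (lookup (clusters σ) i) hu
      in k , inCluster⇒matches _ hk

    model-covered : ∀ k → ∃₂ λ i s → Matches k (lookup (clusters σ) i) s
    model-covered k with ∨-elim (□-elim {u = just (k , false)} (∧-elimʳ (∧-elimʳ hσ)) refl)
    ... | inj₁ h = let c , c∈ , hc = ⋁-elim {f = inCluster} (clusters σ) h in
      index c∈ , subst (λ c → ∃ (Matches k c)) (lookup-index c∈) (inCluster⇒matches c hc)
    ... | inj₂ h = let _ , hc = cluster-◇ (seesAll-elim (clusters σ) h (here refl)) in
      fzero , inCluster⇒matches _ (∧-elimˡ hc)

    Triple : Set
    Triple = Fin (ℕ.suc j) × Fin (ℕ.suc (lastCluster σ)) × Bool

    Valid : Triple → Set
    Valid (k , i , s) = Matches k (lookup (clusters σ) i) s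

    valid? : Decidable Valid
    valid? (k , i , s) = matches? k (lookup (clusters σ) i) s

    triples : List Triple
    triples = cartesianProduct (allFin _) (cartesianProduct (allFin _) (false ∷ true ∷ []))

    seed : Triple
    seed = proj₁ (situation-covered fzero) , fzero , proj₁ (proj₂ (situation-covered fzero))

    n : ℕ
    n = length (filter valid? triples)

    -- Putting a valid triple in front makes the list nonempty, so that it can index the clusters.
    triple : Fin (ℕ.suc n) → Triple
    triple = lookup (seed ∷ filter valid? triples)

    triple-valid : ∀ e → Valid (triple e)
    triple-valid fzero    = proj₂ (proj₂ (situation-covered fzero))
    triple-valid (fsuc e) = proj₂ (∈-filter⁻ valid? {xs = triples} (∈-lookup e))

    triple-onto : ∀ t → Valid t → ∃ λ e → triple e ≡ t
    triple-onto t@(k , i , s) v = index t∈ , sym (lookup-index t∈)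
      where
        t∈ : t ∈ seed ∷ filter valid? triples
        t∈ = there (∈-filter⁺ valid?
          (∈-cartesianProduct⁺ (∈-allFin k) (∈-cartesianProduct⁺ (∈-allFin i) (∈-bools s))) v)

    toSituation : World n → World (lastCluster σ)
    toSituation nothing        = nothing
    toSituation (just (e , b)) = just (proj₁ (proj₂ (triple e)) , b)

    toModel : World n → World j
    toModel nothing        = nothing
    toModel (just (e , b)) = just (proj₁ (triple e) , proj₂ (proj₂ (triple e)) xor b)

    SituationCluster : Fin (ℕ.suc n) → Fin (ℕ.suc (lastCluster σ)) → Set
    SituationCluster e i = proj₁ (proj₂ (triple e)) ≡ i

    ModelCluster : Fin (ℕ.suc n) → Fin (ℕ.suc j) → Set
    ModelCluster e k = proj₁ (triple e) ≡ k

    toSituation-bisim : Bisim (Induced SituationCluster (λ _ → false))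
    toSituation-bisim = induced-bisim (λ _ → _ , refl) λ i →
      let k , s , v = situation-covered i ; e , te = triple-onto (k , i , s) v in e , cong (proj₁ ∘′ proj₂) te

    toModel-bisim : Bisim (Induced ModelCluster (proj₂ ∘′ proj₂ ∘′ triple))
    toModel-bisim = induced-bisim (λ _ → _ , refl) λ k →
      let i , s , v = model-covered k ; e , te = triple-onto (k , i , s) v in e , cong proj₁ te

    cluster-of : Fin (ℕ.suc n) → Assignment²
    cluster-of e = lookup (clusters σ) (proj₁ (proj₂ (triple e)))

    refined : Valuation n
    refined p x = merge p (model σ p (toSituation x)) (V p (toModel x))

    agree⁺ : ∀ x {p} → Allowed⁺ p → model σ p (toSituation x) ≡ true → V p (toModel x) ≡ true
    agree⁺ nothing        = lits-sound⁺ (proj₁ σ) (∧-elimˡ hσ)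
    agree⁺ (just (e , b)) = lits-sound⁺ (side b (cluster-of e)) (matches-side (triple-valid e) b)

    agree⁻ : ∀ x {p} → Allowed⁻ p → V p (toModel x) ≡ true → model σ p (toSituation x) ≡ true
    agree⁻ nothing        = lits-sound⁻ (proj₁ σ) (∧-elimˡ hσ)
    agree⁻ (just (e , b)) = lits-sound⁻ (side b (cluster-of e)) (matches-side (triple-valid e) b)

    refined-φ : Satisfies σ → eval n refined nothing φ ≡ true
    refined-φ = preserves (flip-bisim toSituation-bisim) φ up down root
      where
        up : Transfers {Z = flip (Induced SituationCluster (λ _ → false))} (model σ) refined (v⁺ φ)
        up m root                 = situation⇒merge m (agree⁺ nothing)
        up m (cluster {e} b refl) = situation⇒merge m (agree⁺ (just (e , b)))

        down : Transfers {Z = Induced SituationCluster (λ _ → false)} refined (model σ) (v⁻ φ)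
        down m root                 = merge⇒situation m (agree⁻ nothing)
        down m (cluster {e} b refl) = merge⇒situation m (agree⁻ (just (e , b)))

    refined-ψ : ∀ ψ → (∀ p → p ∈ v⁺ ψ → p ∉ P⁺) → (∀ p → p ∈ v⁻ ψ → p ∉ P⁻) →
                eval n refined nothing ψ ≡ true → nothing ⊩ ψ
    refined-ψ ψ hp hn h = sat (preserves toModel-bisim ψ up down root h)
      where
        up : Transfers {Z = Induced ModelCluster (proj₂ ∘′ proj₂ ∘′ triple)} refined V (v⁺ ψ)
        up {p} m root             = merge⇒model (hp p m)
        up {p} m (cluster b refl) = merge⇒model (hp p m)

        down : Transfers {Z = flip (Induced ModelCluster (proj₂ ∘′ proj₂ ∘′ triple))} V refined (v⁻ ψ)
        down {p} m root             = model⇒merge (hn p m)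
        down {p} m (cluster b refl) = model⇒merge (hn p m)

  φ⇒interpolant : ValidAtRoots (φ ⇒' interpolant)
  φ⇒interpolant j V = truth (⇒-intro (Abstraction.root-φ⇒interpolant V))
    where open Semantics V

  interpolant⇒ψ : ∀ ψ → ⊢Γ (φ ⇒' ψ) → (∀ p → p ∈ v⁺ ψ → p ∉ P⁺) → (∀ p → p ∈ v⁻ ψ → p ∉ P⁻) →
                  ValidAtRoots (interpolant ⇒' ψ)
  interpolant⇒ψ ψ ⊢φ⇒ψ hp hn j V = truth (⇒-intro through-situation)
    where
      open Semantics V

      through-situation : nothing ⊩ interpolant → nothing ⊩ ψ
      through-situation h with ⋁-elim (filter satisfies? situations) h
      ... | σ , σ∈ , hσ = refined-ψ ψ hp hn (⇒ᵇ-elim (⊢φ⇒ψ n refined nothing) (refined-φ σ-satisfies))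
        where
          open Refinement V σ hσ
          σ-satisfies : Satisfies σ
          σ-satisfies = proj₂ (∈-filter⁻ satisfies? {xs = situations} σ∈)

theorem8p2 : UniformLyndonInterpolation ⊢Γ
theorem8p2 φ P⁺ P⁻ =
  interpolant ,
  valid-from-roots (φ ⇒' interpolant) φ⇒interpolant ,
  (λ p → All.lookup (positive admissible-interpolant)) ,
  (λ p → All.lookup (negative admissible-interpolant)) ,
  λ ψ ⊢φ⇒ψ hp hn → valid-from-roots (interpolant ⇒' ψ) (interpolant⇒ψ ψ ⊢φ⇒ψ hp hn)
  where open Interpolant φ P⁺ P⁻
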